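{- For every $r\in\mathbb N\cup\{\infty\}$ and every graph $G$, $\mathrm{bfw}_r(G)\le \mathrm{bcw}_r(G)+2^{\mathrm{bcw}_r(G)}$.
   Context: All graphs are finite, simple and undirected. For $r\in\mathbb N\cup\{\infty\}$, a blind cop strategy of radius $r$ is a sequence $C_1,\dots,C_m\subseteq V(G)$ using $\max_i|C_i|$ cops, with $A_1=V(G)\setminus C_1$ and $A_{i+1}$ the set of $u\in V(G)\setminus C_{i+1}$ reachable from some vertex of $A_i$ by a path of length at most $r$ (length $0$ allowed; any length if $r=\infty$) in $G\setminus(C_i\cap C_{i+1})$; it is winning if $A_m=\emptyset$; $\mathrm{bcw}_r(G)$ is the minimum number of cops of a winning strategy. A $k$-flip of $G$ is a pair $(\mathcal P,F)$ with $\mathcal P$ a partition of $V(G)$ into at most $k$ parts and $F$ a graph (loops allowed) on vertex set $\mathcal P$; flipping $G$ by $(\mathcal P,F)$ yields the graph on $V(G)$ where distinct $u\in P$, $v\in Q$ are adjacent iff exactly one of $\{u,v\}\in E(G)$ and $\{P,Q\}\in E(F)$ holds. In the blind radius-$r$ flipper game the flipper fixes a sequence of $k$-flips $f_1,\dots,f_m$; $G_0=G$ and $G_i$ is $G$ flipped by $f_i$. $R_0$ is the set of non-isolated vertices of $G_0$, and for $i\ge1$, $R_i$ is the set of vertices non-isolated in $G_i$ reachable by a path of length at most $r$ in $G_{i-1}$ from a vertex of $R_{i-1}$. The flipper wins if $R_m=\emptyset$. $\mathrm{bfw}_r(G)$ is the minimum $k$ for which the flipper has a winning sequence of $k$-flips.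 -}

module Defs where

open import Data.Nat using (ℕ; zero; suc; _⊔_; _≤_)
open import Data.Fin using (Fin; _≟_)
open import Data.Fin.Subset using (Subset; _∈_; _∉_; _∩_; ∣_∣)
open import Data.Bool using (Bool; true; false; if_then_else_; _xor_)
open import Data.List using (List; []; _∷_; foldr)
open import Data.Product using (Σ; ∃; _×_; _,_)
open import Relation.Nullary using (¬_; does)
open import Relation.Binary.PropositionalEquality using (_≡_)

record Graph : Set where
  field
    n     : ℕ
    adj   : Fin n → Fin n → Bool
    sym   : ∀ u v → adj u v ≡ adj v u
    irrefl : ∀ v → adj v v ≡ false
open Graph public

data Radius : Set where
  fin : ℕ → Radius
  ∞   : Radius

-- Walk u ⇝ v of length at most k along edge relation E (length 0 allowed)
data Reach {n : ℕ} (E : Fin n → Fin n → Set) : ℕ → Fin n → Fin n → Set where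
  here : ∀ {k u} → Reach E k u u
  step : ∀ {k u w v} → E u w → Reach E k w v → Reach E (suc k) u v

Within : {n : ℕ} → (Fin n → Fin n → Set) → Radius → Fin n → Fin n → Set
Within E (fin k) u v = Reach E k u v
Within E ∞ u v = ∃ λ k → Reach E k u v

EdgeMinus : (G : Graph) → Subset (n G) → Fin (n G) → Fin (n G) → Set
EdgeMinus G X u v = (adj G u v ≡ true) × (u ∉ X) × (v ∉ X)

A-step : (G : Graph) → Radius → (Cprev Cnext : Subset (n G)) →
         (Fin (n G) → Set) → Fin (n G) → Set
A-step G r Cprev Cnext A u =
  (u ∉ Cnext) × ∃ λ v → A v × Within (EdgeMinus G (Cprev ∩ Cnext)) r v u

A-run : (G : Graph) → Radius → Subset (n G) → (Fin (n G) → Set) →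
        List (Subset (n G)) → Fin (n G) → Set
A-run G r Cprev A [] = A
A-run G r Cprev A (C ∷ Cs) = A-run G r C (A-step G r Cprev C A) Cs

A-final : (G : Graph) → Radius → Subset (n G) → List (Subset (n G)) → Fin (n G) → Set
A-final G r C₁ Cs = A-run G r C₁ (λ u → u ∉ C₁) Cs

numCops : {m : ℕ} → Subset m → List (Subset m) → ℕ
numCops C₁ Cs = foldr (λ C k → ∣ C ∣ ⊔ k) ∣ C₁ ∣ Cs

CopsWin : Radius → Graph → ℕ → Set
CopsWin r G k = Σ (Subset (n G)) λ C₁ → Σ (List (Subset (n G))) λ Cs →
  (numCops C₁ Cs ≡ k) × (∀ u → ¬ A-final G r C₁ Cs u)

-- a k-flip: partition into at most k parts given by a labelling Fin n → Fin k,
-- and a graph with loops F on the parts (symmetric Boolean relation)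
record Flip (m k : ℕ) : Set where
  field
    part : Fin m → Fin k
    F    : Fin k → Fin k → Bool
    Fsym : ∀ i j → F i j ≡ F j i
open Flip public

flipAdj : (G : Graph) → {k : ℕ} → Flip (n G) k → Fin (n G) → Fin (n G) → Bool
flipAdj G f u v =
  if does (u ≟ v) then false else (adj G u v xor F f (part f u) (part f v))

NonIsolated : {m : ℕ} → (Fin m → Fin m → Bool) → Fin m → Set
NonIsolated E v = ∃ λ w → E v w ≡ true

BoolEdge : {m : ℕ} → (Fin m → Fin m → Bool) → Fin m → Fin m → Set
BoolEdge E u v = E u v ≡ true

R-step : {m : ℕ} → Radius → (Eprev Enext : Fin m → Fin m → Bool) →
         (Fin m → Set) → Fin m → Set
R-step r Eprev Enext R v =
  NonIsolated Enext v × ∃ λ u → R u × Within (BoolEdge Eprev) r u v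

R-run : (G : Graph) → {k : ℕ} → Radius → (Fin (n G) → Fin (n G) → Bool) →
        (Fin (n G) → Set) → List (Flip (n G) k) → Fin (n G) → Set
R-run G r Eprev R [] = R
R-run G r Eprev R (f ∷ fs) = R-run G r (flipAdj G f) (R-step r Eprev (flipAdj G f) R) fs

R-final : (G : Graph) → {k : ℕ} → Radius → List (Flip (n G) k) → Fin (n G) → Set
R-final G r fs = R-run G r (adj G) (NonIsolated (adj G)) fs

FlipperWins : Radius → Graph → ℕ → Set
FlipperWins r G k = Σ (List (Flip (n G) k)) λ fs → ∀ v → ¬ R-final G r fs v

IsMinimum : (ℕ → Set) → ℕ → Set
IsMinimum P k = P k × (∀ j → P j → k ≤ j)

IsBcw : Radius → Graph → ℕ → Set
IsBcw r G c = IsMinimum (CopsWin r G) c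

IsBfw : Radius → Graph → ℕ → Set
IsBfw r G f = IsMinimum (FlipperWins r G) f

module Submission where

-- A blind cop strategy C₁, …, C_m with c cops is simulated by flips turning G into G ∖ C_i.
-- Such a flip needs only c + 2^c parts: every cop forms its own part, and the remaining
-- vertices are grouped by their neighbourhood in C_i. Whether an edge touches C_i then
-- depends only on the parts of its ends, so these edges can be flipped away. By induction
-- the flipper's set R_i stays inside the cops' set A_i: a vertex that is non-isolated in
-- G ∖ C_i is no cop, and G ∖ C_{i-1} is a subgraph of G ∖ (C_{i-1} ∩ C_i).

open import Defs hiding (sym)
open import Data.Nat using (ℕ; _+_; _^_; _≤_; _⊔_)
import Data.Nat.Properties as ℕ
open import Data.Fin as Fin using (Fin; zero; suc; inject≤; join; splitAt; funToFin; finToFun)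
import Data.Fin.Properties as Fin
open import Data.Fin.Subset using (Subset; _∈_; _∉_; _∩_; ∣_∣; inside; outside)
open import Data.Fin.Subset.Properties using (_∈?_; p∩q⊆p)
open import Data.Vec using (_∷_; here; there)
open import Data.Bool using (Bool; true; false; _∧_; _∨_; _xor_)
import Data.Bool.Properties as Bool
open import Data.List using (List; []; _∷_)
open import Data.List.Relation.Unary.All as All using (All; []; _∷_)
open import Data.Product using (∃₂; _×_; _,_; proj₁; proj₂)
open import Data.Empty using (⊥-elim)
open import Data.Sum as Sum using (_⊎_; inj₁; inj₂)
import Data.Sum.Properties as Sum
open import Function using (_∘_; Inverse; mk⇔)
open import Relation.Nullary using (Dec; yes; no; does)
open import Relation.Nullary.Decidable using (_×-dec_; dec-true; dec-false; does-⇔)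
open import Relation.Unary using (_⊆_)
open import Relation.Binary.PropositionalEquality
  using (_≡_; refl; sym; trans; cong; cong₂; module ≡-Reasoning)

private
  variable
    m m′ k k′ : ℕ

member : (p : Subset m) → Fin ∣ p ∣ → Fin m
member (inside ∷ p) zero = zero
member (inside ∷ p) (suc i) = suc (member p i)
member (outside ∷ p) i = suc (member p i)

index : (p : Subset m) {x : Fin m} → x ∈ p → Fin ∣ p ∣
index (inside ∷ p) here = zero
index (inside ∷ p) (there x∈p) = suc (index p x∈p)
index (outside ∷ p) (there x∈p) = index p x∈p

member-index : (p : Subset m) {x : Fin m} (x∈p : x ∈ p) → member p (index p x∈p) ≡ x
member-index (inside ∷ p) here = refl
member-index (inside ∷ p) (there x∈p) = cong suc (member-index p x∈p)
member-index (outside ∷ p) (there x∈p) = cong suc (member-index p x∈p)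

index-injective : (p : Subset m) {x y : Fin m} (x∈p : x ∈ p) (y∈p : y ∈ p) →
                  index p x∈p ≡ index p y∈p → x ≡ y
index-injective p x∈p y∈p eq = begin
  _                         ≡⟨ member-index p x∈p ⟨
  member p (index p x∈p)    ≡⟨ cong (member p) eq ⟩
  member p (index p y∈p)    ≡⟨ member-index p y∈p ⟩
  _                         ∎
  where open ≡-Reasoning

restrictionCode : (p : Subset m) → (Fin m → Bool) → Fin (2 ^ ∣ p ∣)
restrictionCode p a = funToFin (Inverse.from Fin.2↔Bool ∘ a ∘ member p)

restrictionCode-decode : (p : Subset m) (a : Fin m → Bool) (i : Fin ∣ p ∣) →
  Inverse.to Fin.2↔Bool (finToFun (restrictionCode p a) i) ≡ a (member p i)
restrictionCode-decode p a i = begin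
  Inverse.to Fin.2↔Bool (finToFun (restrictionCode p a) i)
    ≡⟨ cong (Inverse.to Fin.2↔Bool) (Fin.finToFun-funToFin (Inverse.from Fin.2↔Bool ∘ a ∘ member p) i) ⟩
  Inverse.to Fin.2↔Bool (Inverse.from Fin.2↔Bool (a (member p i)))
    ≡⟨ Inverse.strictlyInverseˡ Fin.2↔Bool (a (member p i)) ⟩
  a (member p i) ∎
  where open ≡-Reasoning

restrictionCode-injective : (p : Subset m) (a b : Fin m → Bool) →
  restrictionCode p a ≡ restrictionCode p b → ∀ {x} → x ∈ p → a x ≡ b x
restrictionCode-injective p a b eq {x} x∈p = begin
  a x                           ≡⟨ cong a (member-index p x∈p) ⟨
  a (member p i)                ≡⟨ restrictionCode-decode p a i ⟨
  decode (restrictionCode p a)  ≡⟨ cong decode eq ⟩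
  decode (restrictionCode p b)  ≡⟨ restrictionCode-decode p b i ⟩
  b (member p i)                ≡⟨ cong b (member-index p x∈p) ⟩
  b x                           ∎
  where
  open ≡-Reasoning
  i = index p x∈p
  decode : Fin (2 ^ ∣ p ∣) → Bool
  decode c = Inverse.to Fin.2↔Bool (finToFun c i)

embed : m ≤ m′ → k ≤ k′ → Fin m ⊎ Fin k → Fin (m′ + k′)
embed m≤m′ k≤k′ = join _ _ ∘ Sum.map (λ i → inject≤ i m≤m′) (λ j → inject≤ j k≤k′)

embed-injective : (m≤m′ : m ≤ m′) (k≤k′ : k ≤ k′) {a b : Fin m ⊎ Fin k} →
                  embed m≤m′ k≤k′ a ≡ embed m≤m′ k≤k′ b → a ≡ b
embed-injective {m = m} {m′ = m′} {k = k} {k′ = k′} m≤m′ k≤k′ {a} {b} eq = go a b split-eq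
  where
  inject : Fin m ⊎ Fin k → Fin m′ ⊎ Fin k′
  inject = Sum.map (λ i → inject≤ i m≤m′) (λ j → inject≤ j k≤k′)

  split-eq : inject a ≡ inject b
  split-eq = begin
    inject a                        ≡⟨ Fin.splitAt-join m′ k′ (inject a) ⟨
    splitAt m′ (embed m≤m′ k≤k′ a)  ≡⟨ cong (splitAt m′) eq ⟩
    splitAt m′ (embed m≤m′ k≤k′ b)  ≡⟨ Fin.splitAt-join m′ k′ (inject b) ⟩
    inject b                        ∎
    where open ≡-Reasoning

  go : ∀ a b → inject a ≡ inject b → a ≡ b
  go (inj₁ i) (inj₁ j) e = cong inj₁ (Fin.inject≤-injective m≤m′ m≤m′ i j (Sum.inj₁-injective e))
  go (inj₂ i) (inj₂ j) e = cong inj₂ (Fin.inject≤-injective k≤k′ k≤k′ i j (Sum.inj₂-injective e))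
  go (inj₁ _) (inj₂ _) ()
  go (inj₂ _) (inj₁ _) ()

module Quotient (label : Fin m → Fin k) (g : Fin m → Fin m → Bool)
  (g-respects : ∀ {x y u v} → label x ≡ label u → label y ≡ label v → g x y ≡ g u v)
  where

  Realised : Fin k → Fin k → Set
  Realised a b = ∃₂ λ x y → label x ≡ a × label y ≡ b × g x y ≡ true

  realised? : ∀ a b → Dec (Realised a b)
  realised? a b = Fin.any? λ x → Fin.any? λ y →
    (label x Fin.≟ a) ×-dec (label y Fin.≟ b) ×-dec (g x y Bool.≟ true)

  quotient : Fin k → Fin k → Bool
  quotient a b = does (realised? a b)

  quotient-label : ∀ u v → quotient (label u) (label v) ≡ g u v
  quotient-label u v with realised? (label u) (label v)
  ... | yes (x , y , ex , ey , gxy) = trans (sym gxy) (g-respects ex ey)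
  ... | no ¬realised with g u v in guv
  ...   | true  = ⊥-elim (¬realised (u , v , refl , refl , guv))
  ...   | false = refl

  quotient-sym : (∀ x y → g x y ≡ g y x) → ∀ a b → quotient a b ≡ quotient b a
  quotient-sym g-sym a b = does-⇔ (mk⇔ swap swap) (realised? a b) (realised? b a)
    where
    swap : ∀ {a b} → Realised a b → Realised b a
    swap (x , y , ex , ey , gxy) = y , x , ey , ex , trans (g-sym y x) gxy

flipAdj-true : (G : Graph) (f : Flip (n G) k) {u v : Fin (n G)} →
  flipAdj G f u v ≡ true → adj G u v xor F f (part f u) (part f v) ≡ true
flipAdj-true G f {u} {v} e with u Fin.≟ v
... | no _ = e

EdgeMinus-∩ˡ : (G : Graph) (X Y : Subset (n G)) →
  ∀ {u v} → EdgeMinus G X u v → EdgeMinus G (X ∩ Y) u v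
EdgeMinus-∩ˡ G X Y (uv , u∉X , v∉X) = uv , u∉X ∘ p∩q⊆p X Y , v∉X ∘ p∩q⊆p X Y

module CopFlip (G : Graph) (C : Subset (n G)) where

  inC : Fin (n G) → Bool
  inC x = does (x ∈? C)

  incident : Fin (n G) → Fin (n G) → Bool
  incident x y = (inC x ∨ inC y) ∧ adj G x y

  incident-sym : ∀ x y → incident x y ≡ incident y x
  incident-sym x y = cong₂ _∧_ (Bool.∨-comm (inC x) (inC y)) (Graph.sym G x y)

  incident-copˡ : ∀ {x} y → x ∈ C → incident x y ≡ adj G x y
  incident-copˡ {x} y x∈C rewrite dec-true (x ∈? C) x∈C = refl

  incident-copʳ : ∀ x {y} → y ∈ C → incident x y ≡ adj G x y
  incident-copʳ x {y} y∈C rewrite dec-true (y ∈? C) y∈C | Bool.∨-zeroʳ (inC x) = refl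

  incident-outside : ∀ {x y} → x ∉ C → y ∉ C → incident x y ≡ false
  incident-outside {x} {y} x∉C y∉C rewrite dec-false (x ∈? C) x∉C | dec-false (y ∈? C) y∉C = refl

  data Twins : Fin (n G) → Fin (n G) → Set where
    same    : ∀ {x} → Twins x x
    twins   : ∀ {x u} → x ∉ C → u ∉ C → (∀ {w} → w ∈ C → adj G x w ≡ adj G u w) → Twins x u

  incident-twinʳ : ∀ x {y v} → y ∉ C → v ∉ C → (∀ {w} → w ∈ C → adj G y w ≡ adj G v w) →
                   incident x y ≡ incident x v
  incident-twinʳ x {y} {v} y∉C v∉C nbhd = by-cases (x ∈? C)
    where
    open ≡-Reasoning
    by-cases : Dec (x ∈ C) → incident x y ≡ incident x v
    by-cases (no x∉C) = trans (incident-outside x∉C y∉C) (sym (incident-outside x∉C v∉C))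
    by-cases (yes x∈C) = begin
      incident x y  ≡⟨ incident-copˡ y x∈C ⟩
      adj G x y     ≡⟨ Graph.sym G x y ⟩
      adj G y x     ≡⟨ nbhd x∈C ⟩
      adj G v x     ≡⟨ Graph.sym G v x ⟩
      adj G x v     ≡⟨ incident-copˡ v x∈C ⟨
      incident x v  ∎

  incident-twins : ∀ {x y u v} → Twins x u → Twins y v → incident x y ≡ incident u v
  incident-twins same same = refl
  incident-twins {x} same (twins y∉C v∉C nbhd) = incident-twinʳ x y∉C v∉C nbhd
  incident-twins {y = y} (twins x∉C u∉C nbhd) same = begin
    incident _ y  ≡⟨ incident-sym _ y ⟩
    incident y _  ≡⟨ incident-twinʳ y x∉C u∉C nbhd ⟩
    incident y _  ≡⟨ incident-sym y _ ⟩
    incident _ y  ∎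
    where open ≡-Reasoning
  incident-twins (twins x∉C u∉C _) (twins y∉C v∉C _) =
    trans (incident-outside x∉C y∉C) (sym (incident-outside u∉C v∉C))

  labelDec : ∀ x → Dec (x ∈ C) → Fin ∣ C ∣ ⊎ Fin (2 ^ ∣ C ∣)
  labelDec x (yes x∈C) = inj₁ (index C x∈C)
  labelDec x (no _)    = inj₂ (restrictionCode C (adj G x))

  label : Fin (n G) → Fin ∣ C ∣ ⊎ Fin (2 ^ ∣ C ∣)
  label x = labelDec x (x ∈? C)

  label-twins : ∀ {x u} → label x ≡ label u → Twins x u
  label-twins {x} {u} eq with x ∈? C | u ∈? C
  ... | yes x∈C | yes u∈C with refl ← index-injective C x∈C u∈C (Sum.inj₁-injective eq) = same
  ... | no x∉C  | no u∉C  =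
    twins x∉C u∉C (restrictionCode-injective C (adj G x) (adj G u) (Sum.inj₂-injective eq))
  ... | yes _ | no _ with () ← eq
  ... | no _ | yes _ with () ← eq

  module _ {c : ℕ} (∣C∣≤c : ∣ C ∣ ≤ c) where

    encode : Fin (n G) → Fin (c + 2 ^ c)
    encode = embed ∣C∣≤c (ℕ.^-monoʳ-≤ 2 ∣C∣≤c) ∘ label

    encode-twins : ∀ {x u} → encode x ≡ encode u → Twins x u
    encode-twins = label-twins ∘ embed-injective ∣C∣≤c (ℕ.^-monoʳ-≤ 2 ∣C∣≤c)

    open Quotient encode incident
      (λ ex ey → incident-twins (encode-twins ex) (encode-twins ey))

    copFlip : Flip (n G) (c + 2 ^ c)
    copFlip = record { part = encode ; F = quotient ; Fsym = quotient-sym incident-sym }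

    copFlip-edge : ∀ {u v} → flipAdj G copFlip u v ≡ true → EdgeMinus G C u v
    copFlip-edge {u} {v} flipped = by-cases (u ∈? C) (v ∈? C)
      where
      toggled : adj G u v xor incident u v ≡ true
      toggled = trans (cong (adj G u v xor_) (sym (quotient-label u v))) (flipAdj-true G copFlip flipped)

      untoggled : incident u v ≡ adj G u v → EdgeMinus G C u v
      untoggled eq with () ← trans (sym (Bool.xor-same (adj G u v)))
                               (trans (cong (adj G u v xor_) (sym eq)) toggled)

      by-cases : Dec (u ∈ C) → Dec (v ∈ C) → EdgeMinus G C u v
      by-cases (yes u∈C) _         = untoggled (incident-copˡ v u∈C)
      by-cases _         (yes v∈C) = untoggled (incident-copʳ u v∈C)
      by-cases (no u∉C)  (no v∉C)  = adj-true , u∉C , v∉C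
        where
        open ≡-Reasoning
        adj-true : adj G u v ≡ true
        adj-true = begin
          adj G u v                   ≡⟨ Bool.xor-identityʳ (adj G u v) ⟨
          adj G u v xor false         ≡⟨ cong (adj G u v xor_) (incident-outside u∉C v∉C) ⟨
          adj G u v xor incident u v  ≡⟨ toggled ⟩
          true                        ∎

    copFlip-nonIsolated : ∀ {u} → NonIsolated (flipAdj G copFlip) u → u ∉ C
    copFlip-nonIsolated (_ , flipped) = proj₁ (proj₂ (copFlip-edge flipped))

open CopFlip using (copFlip; copFlip-edge; copFlip-nonIsolated)

Reach-mono : {E E′ : Fin m → Fin m → Set} → (∀ {u v} → E u v → E′ u v) →
             ∀ {j u v} → Reach E j u v → Reach E′ j u v
Reach-mono E⊆E′ here = here
Reach-mono E⊆E′ (step e path) = step (E⊆E′ e) (Reach-mono E⊆E′ path)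

Within-mono : {E E′ : Fin m → Fin m → Set} → (∀ {u v} → E u v → E′ u v) →
              ∀ r {u v} → Within E r u v → Within E′ r u v
Within-mono E⊆E′ (fin _) path = Reach-mono E⊆E′ path
Within-mono E⊆E′ ∞ (j , path) = j , Reach-mono E⊆E′ path

numCops-bounds : (C₁ : Subset m) (Cs : List (Subset m)) →
                 All (λ C → ∣ C ∣ ≤ numCops C₁ Cs) (C₁ ∷ Cs)
numCops-bounds C₁ [] = ℕ.≤-refl ∷ []
numCops-bounds C₁ (C ∷ Cs) with numCops-bounds C₁ Cs
... | b₁ ∷ bs = weaken b₁ ∷ ℕ.m≤m⊔n ∣ C ∣ _ ∷ All.map weaken bs
  where
  weaken : ∀ {j} → j ≤ numCops C₁ Cs → j ≤ ∣ C ∣ ⊔ numCops C₁ Cs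
  weaken j≤ = ℕ.≤-trans j≤ (ℕ.m≤n⊔m ∣ C ∣ _)

module Simulation (G : Graph) (r : Radius) {c : ℕ} where

  copFlips : {Cs : List (Subset (n G))} → All (λ C → ∣ C ∣ ≤ c) Cs → List (Flip (n G) (c + 2 ^ c))
  copFlips = All.reduce (λ {C} → copFlip G C)

  R-step⊆A-step : ∀ Cprev C (≤c : ∣ Cprev ∣ ≤ c) (≤c′ : ∣ C ∣ ≤ c) {R A : Fin (n G) → Set} → R ⊆ A →
    R-step r (flipAdj G (copFlip G Cprev ≤c)) (flipAdj G (copFlip G C ≤c′)) R ⊆ A-step G r Cprev C A
  R-step⊆A-step Cprev C ≤c ≤c′ R⊆A (nonIsolated , u , Ru , path) =
    copFlip-nonIsolated G C ≤c′ nonIsolated , u , R⊆A Ru ,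
    Within-mono (EdgeMinus-∩ˡ G Cprev C ∘ copFlip-edge G Cprev ≤c) r path

  R-run⊆A-run : ∀ Cprev (≤c : ∣ Cprev ∣ ≤ c) {R A : Fin (n G) → Set} → R ⊆ A →
    ∀ Cs (≤cs : All (λ C → ∣ C ∣ ≤ c) Cs) →
    R-run G r (flipAdj G (copFlip G Cprev ≤c)) R (copFlips ≤cs) ⊆ A-run G r Cprev A Cs
  R-run⊆A-run Cprev ≤c R⊆A [] [] = R⊆A
  R-run⊆A-run Cprev ≤c R⊆A (C ∷ Cs) (≤c′ ∷ ≤cs) =
    R-run⊆A-run C ≤c′ (R-step⊆A-step Cprev C ≤c ≤c′ R⊆A) Cs ≤cs

  copsWin⇒flipperWins : CopsWin r G c → FlipperWins r G (c + 2 ^ c)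
  copsWin⇒flipperWins (C₁ , Cs , refl , copsWin) with numCops-bounds C₁ Cs
  ... | ≤c₁ ∷ ≤cs = copFlips (≤c₁ ∷ ≤cs) , λ v Rv →
    copsWin v (R-run⊆A-run C₁ ≤c₁ (copFlip-nonIsolated G C₁ ≤c₁ ∘ proj₁) Cs ≤cs Rv)

lemma5p3 : (r : Radius) (G : Graph) (c f : ℕ) →
    IsBcw r G c → IsBfw r G f → f ≤ c + 2 ^ c
lemma5p3 r G c f (copsWin , _) (_ , bfw-minimal) =
  bfw-minimal (c + 2 ^ c) (Simulation.copsWin⇒flipperWins G r copsWin)
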